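{- Let $G$ be a minimal non-odd-transversal $k$-uniform hypergraph with $n$ vertices and $m$ edges. Then $k$ is even. If moreover $G$ is $d$-regular, then $d$ is even and $d\le k$.
   Context: A hypergraph $G=(V,E)$ has a finite vertex set and an edge set of distinct nonempty subsets of $V$, with no isolated vertices; it is $k$-uniform if every edge has $k$ vertices and $d$-regular if every vertex lies in exactly $d$ edges. A subset $U\subseteq V$ is an odd transversal if every edge meets $U$ in an odd number of vertices; $G$ is odd-transversal if it has an odd transversal; $G$ is minimal non-odd-transversal if it is not odd-transversal but $G-e$ (delete the edge $e$ from $E$) is odd-transversal for every edge $e$. -}

module Defs where

open import Data.Nat using (ℕ; _≤_)
open import Data.Nat.Divisibility using (_∣_)
open import Data.Fin using (Fin)
open import Data.Fin.Subset using (Subset; _∈_; _∩_; ∣_∣; Nonempty)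
open import Data.Fin.Subset.Properties using (_∈?_)
open import Data.Vec using (count; allFin)
open import Data.Product using (Σ; ∃; _×_)
open import Relation.Nullary using (¬_)
open import Relation.Binary.PropositionalEquality using (_≡_; _≢_)
open import Function.Definitions using (Injective)

Even : ℕ → Set
Even k = 2 ∣ k

Odd : ℕ → Set
Odd k = ¬ (2 ∣ k)

record Hypergraph (n m : ℕ) : Set where
  field
    edge     : Fin m → Subset n
    distinct : Injective _≡_ _≡_ edge
    nonempty : ∀ i → Nonempty (edge i)
    noIsolated : ∀ (x : Fin n) → ∃ λ i → x ∈ edge i

open Hypergraph public

degree : ∀ {n m} → Hypergraph n m → Fin n → ℕ
degree G x = count (λ i → x ∈? edge G i) (allFin _)

Uniform : ∀ {n m} → ℕ → Hypergraph n m → Set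
Uniform k G = ∀ i → ∣ edge G i ∣ ≡ k

Regular : ∀ {n m} → ℕ → Hypergraph n m → Set
Regular d G = ∀ x → degree G x ≡ d

OddTransversal : ∀ {n m} → Hypergraph n m → Subset n → Set
OddTransversal G U = ∀ i → Odd ∣ edge G i ∩ U ∣

IsOddTransversal : ∀ {n m} → Hypergraph n m → Set
IsOddTransversal {n} G = Σ (Subset n) (OddTransversal G)

IsOddTransversalWithout : ∀ {n m} → Hypergraph n m → Fin m → Set
IsOddTransversalWithout {n} G j =
  Σ (Subset n) λ U → ∀ i → i ≢ j → Odd ∣ edge G i ∩ U ∣

MinimalNonOddTransversal : ∀ {n m} → Hypergraph n m → Set
MinimalNonOddTransversal G =
  ¬ IsOddTransversal G × (∀ j → IsOddTransversalWithout G j)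

{-# OPTIONS --safe #-}
module Submission where

-- Over GF(2), let A be the m × n edge–vertex incidence matrix of G, so that U is an odd
-- transversal exactly when A U = 1.  Minimality provides, for every edge j, a vector U_j with
-- A U_j = 1 + e_j; linear combinations of these solve A u = v for every v of even weight.
-- Since A u = 1 is unsolvable, 1 has odd weight (m is odd) and the image of A consists
-- precisely of the even-weight vectors.  As A 1 = k·1, k is even.  If G is d-regular then
-- 1ᵀ A = d·1ᵀ, so d·(Σ u) = Σ (A u) = 0 for all u, and d is even.  Finally 1 is a nonzero
-- kernel vector while the image has 2^(m-1) elements, so 2^m ≤ 2^n, i.e. m ≤ n, and double
-- counting n d = m k gives d ≤ k.

open import Defs
open import Data.Nat using (ℕ; _≤_)
open import Data.Product using (_×_)

import Algebra
import Algebra.Properties.CommutativeMonoid.Sum as CommutativeMonoidSum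
open import Data.Bool using (Bool; true; false; _∧_) renaming (_≟_ to _≟ᵇ_)
open import Data.Empty using (⊥-elim)
open import Data.Fin using (Fin; zero; suc; punchIn; combine; funToFin; finToFun; _≟_)
open import Data.Fin.Properties using (injective⇒≤; punchInᵢ≢i; funToFin-finToFin; finToFun-funToFin)
open import Data.Fin.Subset using (Subset; _∩_; ∣_∣; ⊤; ⁅_⁆)
open import Data.Fin.Subset.Properties using (_∈?_; ∣⁅x⁆∣≡1)
open import Data.Nat using (zero; suc; _^_; _<_; z≤n; s≤s; parity)
import Data.Nat as ℕ
import Data.Nat.Properties as ℕ
open import Data.Nat.Divisibility using (divides)
open import Data.Parity.Base using (Parity; 0ℙ; 1ℙ)
import Data.Parity.Properties as ℙ
open import Data.Product using (∃; _,_; proj₁; proj₂)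
open import Data.Vec using (_∷_; lookup; tabulate; count)
open import Data.Vec.Properties using (lookup-zipWith; lookup∘tabulate; tabulate∘lookup)
open import Data.Vec.Functional using (Vector; removeAt; tail)
open import Function using (id; _∘_)
open import Relation.Binary.PropositionalEquality
open import Relation.Nullary using (¬_; does; yes; no)
open import Relation.Unary using (Pred; Decidable)

open Algebra.CommutativeRing ℙ.+-*-commutativeRing using (_+_; _*_)
open import Algebra.Properties.AbelianGroup ℙ.+-0-abelianGroup using () renaming (xyx⁻¹≈y to x+y+x≡y)
open import Algebra.Properties.Group ℙ.+-0-group using ()
  renaming (\\-leftDividesʳ to x+[x+y]≡y; //-rightDividesʳ to y+x+x≡y)
open import Algebra.Properties.CommutativeSemigroup ℙ.*-commutativeSemigroup using (x∙yz≈y∙xz)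
open import Algebra.Properties.Semiring.Sum ℙ.+-*-semiring
  using (sum; sum-cong-≗; sum-remove; ∑-comm; ∑-distrib-+; *-distribˡ-sum; *-distribʳ-sum)
module ℕΣ = CommutativeMonoidSum ℕ.+-0-commutativeMonoid

𝟙 : Bool → ℕ
𝟙 true  = 1
𝟙 false = 0

toParity : Bool → Parity
toParity b = parity (𝟙 b)

fromParity : Parity → Bool
fromParity 0ℙ = false
fromParity 1ℙ = true

toParity∘fromParity : ∀ p → toParity (fromParity p) ≡ p
toParity∘fromParity 0ℙ = refl
toParity∘fromParity 1ℙ = refl

toParity-∧ : ∀ a b → toParity (a ∧ b) ≡ toParity a * toParity b
toParity-∧ true  b = refl
toParity-∧ false b = refl

even⇒parity≡0ℙ : ∀ {k} → Even k → parity k ≡ 0ℙ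
even⇒parity≡0ℙ (divides q refl) = trans (ℙ.*-homo-* q 2) (ℙ.*-zeroʳ (parity q))

parity≡0ℙ⇒even : ∀ k → parity k ≡ 0ℙ → Even k
parity≡0ℙ⇒even zero          _  = divides 0 refl
parity≡0ℙ⇒even (suc (suc k)) eq with divides q k≡q*2 ← parity≡0ℙ⇒even k eq =
  divides (suc q) (cong (2 ℕ.+_) k≡q*2)

odd⇒parity≡1ℙ : ∀ {k} → Odd k → parity k ≡ 1ℙ
odd⇒parity≡1ℙ {k} odd with parity k in eq
... | 1ℙ = refl
... | 0ℙ = ⊥-elim (odd (parity≡0ℙ⇒even k eq))

parity≡1ℙ⇒odd : ∀ {k} → parity k ≡ 1ℙ → Odd k
parity≡1ℙ⇒odd eq even with () ← trans (sym eq) (even⇒parity≡0ℙ even)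

ℕΣ-const : ∀ n c → ℕΣ.sum (λ (_ : Fin n) → c) ≡ n ℕ.* c
ℕΣ-const zero    c = refl
ℕΣ-const (suc n) c = cong (c ℕ.+_) (ℕΣ-const n c)

parity-sum : ∀ {n} (f : Vector ℕ n) → parity (ℕΣ.sum f) ≡ sum (parity ∘ f)
parity-sum {zero}  f = refl
parity-sum {suc n} f = trans (ℙ.+-homo-+ (f zero) (ℕΣ.sum (tail f))) (cong (parity (f zero) +_) (parity-sum (tail f)))

count-tabulate : ∀ {a p n} {A : Set a} {P : Pred A p} (P? : Decidable P) (f : Fin n → A) →
                 count P? (tabulate f) ≡ ℕΣ.sum (λ i → 𝟙 (does (P? (f i))))
count-tabulate {n = zero}  P? f = refl
count-tabulate {n = suc n} P? f with does (P? (f zero))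
... | true  = cong suc (count-tabulate P? (f ∘ suc))
... | false = count-tabulate P? (f ∘ suc)

does-∈? : ∀ {n} (x : Fin n) (p : Subset n) → does (x ∈? p) ≡ lookup p x
does-∈? zero    (true  ∷ p) = refl
does-∈? zero    (false ∷ p) = refl
does-∈? (suc x) (b ∷ p)     = does-∈? x p

∣p∣≡∑ : ∀ {n} (p : Subset n) → ∣ p ∣ ≡ ℕΣ.sum (𝟙 ∘ lookup p)
∣p∣≡∑ p = begin
  ∣ p ∣                                         ≡⟨ cong ∣_∣ (tabulate∘lookup p) ⟨
  ∣ tabulate (lookup p) ∣                       ≡⟨ count-tabulate (_≟ᵇ true) (lookup p) ⟩
  ℕΣ.sum (λ x → 𝟙 (does (lookup p x ≟ᵇ true))) ≡⟨ ℕΣ.sum-cong-≗ (cong 𝟙 ∘ does-≟true ∘ lookup p) ⟩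
  ℕΣ.sum (𝟙 ∘ lookup p)                         ∎
  where
  open ≡-Reasoning
  does-≟true : ∀ b → does (b ≟ᵇ true) ≡ b
  does-≟true true  = refl
  does-≟true false = refl

indicator : ∀ {n} → Subset n → Vector Parity n
indicator p = toParity ∘ lookup p

support : ∀ {n} → Vector Parity n → Subset n
support u = tabulate (fromParity ∘ u)

indicator∘support : ∀ {n} (u : Vector Parity n) x → indicator (support u) x ≡ u x
indicator∘support u x = trans (cong toParity (lookup∘tabulate (fromParity ∘ u) x)) (toParity∘fromParity (u x))

parity-∣p∣ : ∀ {n} (p : Subset n) → parity ∣ p ∣ ≡ sum (indicator p)
parity-∣p∣ p = trans (cong parity (∣p∣≡∑ p)) (parity-sum (𝟙 ∘ lookup p))

parity-∣p∩q∣ : ∀ {n} (p q : Subset n) → parity ∣ p ∩ q ∣ ≡ sum (λ x → indicator p x * indicator q x)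
parity-∣p∩q∣ p q = trans (parity-∣p∣ (p ∩ q)) (sum-cong-≗ indicator-∩)
  where
  indicator-∩ : ∀ x → indicator (p ∩ q) x ≡ indicator p x * indicator q x
  indicator-∩ x = trans (cong toParity (lookup-zipWith _∧_ x p q)) (toParity-∧ (lookup p x) (lookup q x))

-- Linear algebra over GF(2)

Matrix : ℕ → ℕ → Set
Matrix m n = Fin m → Fin n → Parity

_·_ : ∀ {m n} → Matrix m n → Vector Parity n → Vector Parity m
(A · u) i = sum (λ x → A i x * u x)

ones : ∀ {n} → Vector Parity n
ones _ = 1ℙ

rowSum : ∀ {m n} → Matrix m n → Vector Parity m
rowSum A i = sum (A i)

columnSum : ∀ {m n} → Matrix m n → Vector Parity n
columnSum A x = sum (λ i → A i x)

·-cong : ∀ {m n} (A : Matrix m n) {u w : Vector Parity n} → (∀ x → u x ≡ w x) → ∀ i → (A · u) i ≡ (A · w) i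
·-cong A u≗w i = sum-cong-≗ (λ x → cong (A i x *_) (u≗w x))

·-ones : ∀ {m n} (A : Matrix m n) i → (A · ones) i ≡ rowSum A i
·-ones A i = sum-cong-≗ (λ x → ℙ.*-identityʳ (A i x))

·-linear : ∀ {m n} (A : Matrix m n) (u w : Vector Parity n) c i →
           (A · (λ x → u x + c * w x)) i ≡ (A · u) i + c * (A · w) i
·-linear A u w c i = begin
  sum (λ x → A i x * (u x + c * w x))          ≡⟨ sum-cong-≗ (λ x → ℙ.*-distribˡ-+ (A i x) (u x) (c * w x)) ⟩
  sum (λ x → A i x * u x + A i x * (c * w x))  ≡⟨ ∑-distrib-+ (λ x → A i x * u x) (λ x → A i x * (c * w x)) ⟩
  (A · u) i + sum (λ x → A i x * (c * w x))    ≡⟨ cong ((A · u) i +_) (sum-cong-≗ (λ x → x∙yz≈y∙xz (A i x) c (w x))) ⟩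
  (A · u) i + sum (λ x → c * (A i x * w x))    ≡⟨ cong ((A · u) i +_) (*-distribˡ-sum c (λ x → A i x * w x)) ⟨
  (A · u) i + c * (A · w) i                    ∎
  where open ≡-Reasoning

·-combination : ∀ {m n k} (A : Matrix m n) (T : Vector Parity k) (U : Fin k → Vector Parity n) i →
                (A · (λ x → sum (λ j → T j * U j x))) i ≡ sum (λ j → T j * (A · U j) i)
·-combination A T U i = begin
  sum (λ x → A i x * sum (λ j → T j * U j x))   ≡⟨ sum-cong-≗ (λ x → *-distribˡ-sum (A i x) (λ j → T j * U j x)) ⟩
  sum (λ x → sum (λ j → A i x * (T j * U j x))) ≡⟨ sum-cong-≗ (λ x → sum-cong-≗ (λ j → x∙yz≈y∙xz (A i x) (T j) (U j x))) ⟩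
  sum (λ x → sum (λ j → T j * (A i x * U j x))) ≡⟨ ∑-comm (λ x j → T j * (A i x * U j x)) ⟩
  sum (λ j → sum (λ x → T j * (A i x * U j x))) ≡⟨ sum-cong-≗ (λ j → *-distribˡ-sum (T j) (λ x → A i x * U j x)) ⟨
  sum (λ j → T j * (A · U j) i)                 ∎
  where open ≡-Reasoning

sum-· : ∀ {m n} (A : Matrix m n) (u : Vector Parity n) → sum (A · u) ≡ sum (λ x → columnSum A x * u x)
sum-· A u = begin
  sum (λ i → sum (λ x → A i x * u x)) ≡⟨ ∑-comm (λ i x → A i x * u x) ⟩
  sum (λ x → sum (λ i → A i x * u x)) ≡⟨ sum-cong-≗ (λ x → *-distribʳ-sum (u x) (λ i → A i x)) ⟨
  sum (λ x → columnSum A x * u x)     ∎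
  where open ≡-Reasoning

∑-offDiagonal : ∀ {m} (v c : Vector Parity m) i → c i ≡ 0ℙ → (∀ j → j ≢ i → c j ≡ 1ℙ) →
                sum (λ j → v j * c j) ≡ sum v + v i
∑-offDiagonal {suc m} v c i cᵢ≡0ℙ c≡1ℙ = begin
  sum (λ j → v j * c j)                             ≡⟨ sum-remove {i = i} (λ j → v j * c j) ⟩
  v i * c i + sum (removeAt (λ j → v j * c j) i)    ≡⟨ cong₂ _+_ (trans (cong (v i *_) cᵢ≡0ℙ) (ℙ.*-zeroʳ (v i)))
                                                                 (sum-cong-≗ off-i) ⟩
  sum (removeAt v i)                                ≡⟨ x+y+x≡y (v i) (sum (removeAt v i)) ⟨
  v i + sum (removeAt v i) + v i                    ≡⟨ cong (_+ v i) (sum-remove {i = i} v) ⟨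
  sum v + v i                                       ∎
  where
  open ≡-Reasoning
  off-i : ∀ j → v (punchIn i j) * c (punchIn i j) ≡ v (punchIn i j)
  off-i j = trans (cong (v (punchIn i j) *_) (c≡1ℙ (punchIn i j) (punchInᵢ≢i i j))) (ℙ.*-identityʳ _)

-- Injections between parity vectors

toFin : Parity → Fin 2
toFin 0ℙ = zero
toFin 1ℙ = suc zero

fromFin : Fin 2 → Parity
fromFin zero       = 0ℙ
fromFin (suc zero) = 1ℙ

fromFin∘toFin : ∀ p → fromFin (toFin p) ≡ p
fromFin∘toFin 0ℙ = refl
fromFin∘toFin 1ℙ = refl

toFin∘fromFin : ∀ i → toFin (fromFin i) ≡ i
toFin∘fromFin zero       = refl
toFin∘fromFin (suc zero) = refl

funToFin-cong : ∀ {a b} {f g : Fin a → Fin b} → (∀ i → f i ≡ g i) → funToFin f ≡ funToFin g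
funToFin-cong {zero}  f≗g = refl
funToFin-cong {suc a} f≗g = cong₂ combine (f≗g zero) (funToFin-cong (f≗g ∘ suc))

encode : ∀ {a} → Vector Parity a → Fin (2 ^ a)
encode u = funToFin (toFin ∘ u)

decode : ∀ a → Fin (2 ^ a) → Vector Parity a
decode a i = fromFin ∘ finToFun i

decode∘encode : ∀ {a} (u : Vector Parity a) x → decode a (encode u) x ≡ u x
decode∘encode u x = trans (cong fromFin (finToFun-funToFin (toFin ∘ u) x)) (fromFin∘toFin (u x))

encode∘decode : ∀ a (i : Fin (2 ^ a)) → encode (decode a i) ≡ i
encode∘decode a i = trans (funToFin-cong (toFin∘fromFin ∘ finToFun {2} {a} i)) (funToFin-finToFin {a} i)

vector-injective⇒≤ : ∀ {a b} (F : Vector Parity a → Vector Parity b) →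
                     (∀ u w → (∀ y → F u y ≡ F w y) → ∀ x → u x ≡ w x) → a ≤ b
vector-injective⇒≤ {a} {b} F F-injective =
  ℕ.≮⇒≥ (λ b<a → ℕ.<⇒≱ (ℕ.^-monoʳ-< 2 (s≤s (s≤s z≤n)) b<a) (injective⇒≤ F′-injective))
  where
  F′ : Fin (2 ^ a) → Fin (2 ^ b)
  F′ = encode ∘ F ∘ decode a
  F′-injective : ∀ {i j} → F′ i ≡ F′ j → i ≡ j
  F′-injective {i} {j} F′i≡F′j = begin
    i                   ≡⟨ encode∘decode a i ⟨
    encode (decode a i) ≡⟨ funToFin-cong (cong toFin ∘ F-injective (decode a i) (decode a j) Fi≗Fj) ⟩
    encode (decode a j) ≡⟨ encode∘decode a j ⟩
    j                   ∎
    where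
    open ≡-Reasoning
    Fi≗Fj : ∀ y → F (decode a i) y ≡ F (decode a j) y
    Fi≗Fj y = begin
      F (decode a i) y                   ≡⟨ decode∘encode (F (decode a i)) y ⟨
      decode b (F′ i) y                  ≡⟨ cong (λ k → decode b k y) F′i≡F′j ⟩
      decode b (F′ j) y                  ≡⟨ decode∘encode (F (decode a j)) y ⟩
      F (decode a j) y                   ∎

-- Minimally unsolvable systems over GF(2)

Solvable : ∀ {m n} → Matrix m n → Vector Parity m → Set
Solvable {n = n} A v = ∃ λ (u : Vector Parity n) → ∀ i → (A · u) i ≡ v i

module MinimallyUnsolvable {m n} (A : Matrix m n) (ones-unsolvable : ¬ Solvable A ones)
         (solvable-off : ∀ j → ∃ λ (u : Vector Parity n) → ∀ i → i ≢ j → (A · u) i ≡ 1ℙ) where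

  U : Fin m → Vector Parity n
  U j = proj₁ (solvable-off j)

  U-diagonal : ∀ j → (A · U j) j ≡ 0ℙ
  U-diagonal j with (A · U j) j in AUⱼⱼ≡1ℙ
  ... | 0ℙ = refl
  ... | 1ℙ = ⊥-elim (ones-unsolvable (U j , AUⱼ≡ones))
    where
    AUⱼ≡ones : ∀ i → (A · U j) i ≡ 1ℙ
    AUⱼ≡ones i with i ≟ j
    ... | yes refl = AUⱼⱼ≡1ℙ
    ... | no i≢j   = proj₂ (solvable-off j) i i≢j

  combination : Vector Parity m → Vector Parity n
  combination T x = sum (λ j → T j * U j x)

  combination-cong : ∀ {T T′} → (∀ j → T j ≡ T′ j) → ∀ x → combination T x ≡ combination T′ x
  combination-cong T≗T′ x = sum-cong-≗ (λ j → cong (_* U j x) (T≗T′ j))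

  -- A · U j is ones plus the j-th unit vector.
  ·-combination-even : ∀ T → sum T ≡ 0ℙ → ∀ i → (A · combination T) i ≡ T i
  ·-combination-even T ∑T≡0ℙ i = begin
    (A · combination T) i         ≡⟨ ·-combination A T U i ⟩
    sum (λ j → T j * (A · U j) i) ≡⟨ ∑-offDiagonal T (λ j → (A · U j) i) i (U-diagonal i)
                                       (λ j j≢i → proj₂ (solvable-off j) i (j≢i ∘ sym)) ⟩
    sum T + T i                   ≡⟨ cong (_+ T i) ∑T≡0ℙ ⟩
    T i                           ∎
    where open ≡-Reasoning

  even⇒solvable : ∀ v → sum v ≡ 0ℙ → Solvable A v
  even⇒solvable v ∑v≡0ℙ = combination v , ·-combination-even v ∑v≡0ℙ

  sum-ones : sum (ones {m}) ≡ 1ℙ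
  sum-ones with sum (ones {m}) in ∑ones≡0ℙ
  ... | 1ℙ = refl
  ... | 0ℙ = ⊥-elim (ones-unsolvable (even⇒solvable ones ∑ones≡0ℙ))

  sum-const : ∀ c → sum (λ (_ : Fin m) → c) ≡ c
  sum-const c = begin
    sum (λ (_ : Fin m) → c)       ≡⟨ sum-cong-≗ {m} (λ _ → ℙ.*-identityʳ c) ⟨
    sum (λ (_ : Fin m) → c * 1ℙ)  ≡⟨ *-distribˡ-sum c (ones {m}) ⟨
    c * sum (ones {m})            ≡⟨ cong (c *_) sum-ones ⟩
    c * 1ℙ                        ≡⟨ ℙ.*-identityʳ c ⟩
    c                             ∎
    where open ≡-Reasoning

  sum-+const : ∀ (v : Vector Parity m) c → sum (λ j → v j + c) ≡ sum v + c
  sum-+const v c = trans (∑-distrib-+ v (λ _ → c)) (cong (sum v +_) (sum-const c))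

  solvable⇒even : ∀ v → Solvable A v → sum v ≡ 0ℙ
  solvable⇒even v (u , Au≡v) with sum v in ∑v≡1ℙ
  ... | 0ℙ = refl
  ... | 1ℙ = ⊥-elim (ones-unsolvable ((λ x → u x + u′ x) , A[u+u′]≡ones))
    where
    v+ones-solvable : Solvable A (λ j → v j + 1ℙ)
    v+ones-solvable = even⇒solvable (λ j → v j + 1ℙ) (trans (sum-+const v 1ℙ) (cong (_+ 1ℙ) ∑v≡1ℙ))
    u′ = proj₁ v+ones-solvable
    A[u+u′]≡ones : ∀ i → (A · (λ x → u x + u′ x)) i ≡ 1ℙ
    A[u+u′]≡ones i = trans (·-linear A u u′ 1ℙ i)
                       (trans (cong₂ _+_ (Au≡v i) (proj₂ v+ones-solvable i)) (x+[x+y]≡y (v i) 1ℙ))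

  rank-bound : ∀ (z : Vector Parity n) x₀ → (∀ i → (A · z) i ≡ 0ℙ) → z x₀ ≡ 1ℙ → m ≤ n
  rank-bound z x₀ Az≡0ℙ zx₀≡1ℙ = vector-injective⇒≤ F F-injective
    where
    -- Applying A to F w recovers shift w, and then coordinate x₀ of F w recovers sum w.
    shift : Vector Parity m → Vector Parity m
    shift w j = w j + sum w

    F : Vector Parity m → Vector Parity n
    F w x = combination (shift w) x + sum w * z x

    A·F : ∀ w i → (A · F w) i ≡ shift w i
    A·F w i = begin
      (A · F w) i                                        ≡⟨ ·-linear A (combination (shift w)) z (sum w) i ⟩
      (A · combination (shift w)) i + sum w * (A · z) i  ≡⟨ cong₂ (λ a b → a + sum w * b)
                                                              (·-combination-even (shift w) sum-shift i) (Az≡0ℙ i) ⟩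
      shift w i + sum w * 0ℙ                             ≡⟨ cong (shift w i +_) (ℙ.*-zeroʳ (sum w)) ⟩
      shift w i + 0ℙ                                     ≡⟨ ℙ.+-identityʳ (shift w i) ⟩
      shift w i                                          ∎
      where
      open ≡-Reasoning
      sum-shift : sum (shift w) ≡ 0ℙ
      sum-shift = trans (sum-+const w (sum w)) (ℙ.p+p≡0ℙ (sum w))

    F-injective : ∀ w w′ → (∀ x → F w x ≡ F w′ x) → ∀ j → w j ≡ w′ j
    F-injective w w′ Fw≗Fw′ j = begin
      w j                   ≡⟨ y+x+x≡y (sum w) (w j) ⟨
      shift w j + sum w     ≡⟨ cong₂ _+_ (shift-injective j) sum-injective ⟩
      shift w′ j + sum w′   ≡⟨ y+x+x≡y (sum w′) (w′ j) ⟩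
      w′ j                  ∎
      where
      open ≡-Reasoning
      shift-injective : ∀ i → shift w i ≡ shift w′ i
      shift-injective i = trans (sym (A·F w i)) (trans (·-cong A Fw≗Fw′ i) (A·F w′ i))
      sum-injective : sum w ≡ sum w′
      sum-injective = begin
        sum w          ≡⟨ ℙ.*-identityʳ (sum w) ⟨
        sum w * 1ℙ     ≡⟨ cong (sum w *_) zx₀≡1ℙ ⟨
        sum w * z x₀   ≡⟨ ℙ.+-cancelˡ-≡ (combination (shift w) x₀) _ _
                            (trans (Fw≗Fw′ x₀) (cong (_+ sum w′ * z x₀) (sym (combination-cong shift-injective x₀)))) ⟩
        sum w′ * z x₀  ≡⟨ cong (sum w′ *_) zx₀≡1ℙ ⟩
        sum w′ * 1ℙ    ≡⟨ ℙ.*-identityʳ (sum w′) ⟩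
        sum w′         ∎

  constant-columnSum≡0ℙ : ∀ c → (∀ x → columnSum A x ≡ c) → (u : Vector Parity n) → sum u ≡ 1ℙ → c ≡ 0ℙ
  constant-columnSum≡0ℙ c columnSum≡c u ∑u≡1ℙ = begin
    c                                  ≡⟨ ℙ.*-identityʳ c ⟨
    c * 1ℙ                             ≡⟨ cong (c *_) ∑u≡1ℙ ⟨
    c * sum u                          ≡⟨ *-distribˡ-sum c u ⟩
    sum (λ x → c * u x)                ≡⟨ sum-cong-≗ (λ x → cong (_* u x) (columnSum≡c x)) ⟨
    sum (λ x → columnSum A x * u x)    ≡⟨ sum-· A u ⟨
    sum (A · u)                        ≡⟨ solvable⇒even (A · u) (u , λ _ → refl) ⟩
    0ℙ                                 ∎
    where open ≡-Reasoning

  constant-rowSum≡0ℙ : ∀ c → (∀ i → rowSum A i ≡ c) → c ≡ 0ℙ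
  constant-rowSum≡0ℙ 0ℙ _         = refl
  constant-rowSum≡0ℙ 1ℙ rowSum≡1ℙ = ⊥-elim (ones-unsolvable (ones , λ i → trans (·-ones A i) (rowSum≡1ℙ i)))

-- Hypergraphs as incidence matrices

incidence : ∀ {n m} → Hypergraph n m → Matrix m n
incidence G i = indicator (edge G i)

module _ {n m} (G : Hypergraph n m) where

  parity-∣edge∩∣ : ∀ i U → parity ∣ edge G i ∩ U ∣ ≡ (incidence G · indicator U) i
  parity-∣edge∩∣ i U = parity-∣p∩q∣ (edge G i) U

  incidence-unsolvable : ¬ IsOddTransversal G → ¬ Solvable (incidence G) ones
  incidence-unsolvable ¬oddTransversal (u , Au≡ones) = ¬oddTransversal (support u , oddTransversal)
    where
    oddTransversal : OddTransversal G (support u)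
    oddTransversal i = parity≡1ℙ⇒odd (begin
      parity ∣ edge G i ∩ support u ∣            ≡⟨ parity-∣edge∩∣ i (support u) ⟩
      (incidence G · indicator (support u)) i    ≡⟨ ·-cong (incidence G) (indicator∘support u) i ⟩
      (incidence G · u) i                        ≡⟨ Au≡ones i ⟩
      1ℙ                                         ∎)
      where open ≡-Reasoning

  incidence-solvable-off : ∀ j → IsOddTransversalWithout G j →
                           ∃ λ (u : Vector Parity n) → ∀ i → i ≢ j → (incidence G · u) i ≡ 1ℙ
  incidence-solvable-off j (U , odd) =
    indicator U , λ i i≢j → trans (sym (parity-∣edge∩∣ i U)) (odd⇒parity≡1ℙ (odd i i≢j))

  degree≡∑ : ∀ x → degree G x ≡ ℕΣ.sum (λ i → 𝟙 (lookup (edge G i) x))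
  degree≡∑ x = trans (count-tabulate (λ i → x ∈? edge G i) id)
                     (ℕΣ.sum-cong-≗ (λ i → cong 𝟙 (does-∈? x (edge G i))))

  uniform-rowSum : ∀ {k} → Uniform k G → ∀ i → rowSum (incidence G) i ≡ parity k
  uniform-rowSum uniform i = trans (sym (parity-∣p∣ (edge G i))) (cong parity (uniform i))

  regular-columnSum : ∀ {d} → Regular d G → ∀ x → columnSum (incidence G) x ≡ parity d
  regular-columnSum {d} regular x = begin
    columnSum (incidence G) x                            ≡⟨ parity-sum (λ i → 𝟙 (lookup (edge G i) x)) ⟨
    parity (ℕΣ.sum (λ i → 𝟙 (lookup (edge G i) x)))     ≡⟨ cong parity (degree≡∑ x) ⟨
    parity (degree G x)                                  ≡⟨ cong parity (regular x) ⟩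
    parity d                                             ∎
    where open ≡-Reasoning

  regular-uniform⇒n*d≡m*k : ∀ {d k} → Regular d G → Uniform k G → n ℕ.* d ≡ m ℕ.* k
  regular-uniform⇒n*d≡m*k {d} {k} regular uniform = begin
    n ℕ.* d                                                  ≡⟨ ℕΣ-const n d ⟨
    ℕΣ.sum (λ (_ : Fin n) → d)                               ≡⟨ ℕΣ.sum-cong-≗ (sym ∘ regular) ⟩
    ℕΣ.sum (degree G)                                        ≡⟨ ℕΣ.sum-cong-≗ degree≡∑ ⟩
    ℕΣ.sum (λ x → ℕΣ.sum (λ i → 𝟙 (lookup (edge G i) x)))   ≡⟨ ℕΣ.∑-comm (λ x i → 𝟙 (lookup (edge G i) x)) ⟩
    ℕΣ.sum (λ i → ℕΣ.sum (𝟙 ∘ lookup (edge G i)))            ≡⟨ ℕΣ.sum-cong-≗ (λ i → trans (sym (∣p∣≡∑ (edge G i))) (uniform i)) ⟩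
    ℕΣ.sum (λ (_ : Fin m) → k)                               ≡⟨ ℕΣ-const m k ⟩
    m ℕ.* k                                                  ∎
    where open ≡-Reasoning

n*d≡m*k⇒d≤k : ∀ {m n d k} → 0 < m → m ≤ n → n ℕ.* d ≡ m ℕ.* k → d ≤ k
n*d≡m*k⇒d≤k {m} {n} {d} {k} 0<m m≤n n*d≡m*k =
  ℕ.*-cancelˡ-≤ n {{ℕ.>-nonZero (ℕ.<-≤-trans 0<m m≤n)}} (ℕ.≤-trans (ℕ.≤-reflexive n*d≡m*k) (ℕ.*-monoˡ-≤ k m≤n))

lemma4p1 : ∀ (n m k : ℕ) (G : Hypergraph n m) → Uniform k G → MinimalNonOddTransversal G →
    Even k × (∀ (d : ℕ) → Regular d G → Even d × d ≤ k)
lemma4p1 n zero    k G _       (¬oddTransversal , _) = ⊥-elim (¬oddTransversal (⊤ , λ ()))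
lemma4p1 n (suc m) k G uniform (¬oddTransversal , oddTransversalWithout) =
  parity≡0ℙ⇒even k parity-k≡0ℙ , λ d regular → parity≡0ℙ⇒even d (parity-d≡0ℙ regular) , d≤k regular
  where
  open MinimallyUnsolvable (incidence G) (incidence-unsolvable G ¬oddTransversal)
                           (λ j → incidence-solvable-off G j (oddTransversalWithout j))
  x₀ : Fin n
  x₀ = proj₁ (nonempty G zero)

  parity-k≡0ℙ : parity k ≡ 0ℙ
  parity-k≡0ℙ = constant-rowSum≡0ℙ (parity k) (uniform-rowSum G uniform)

  parity-d≡0ℙ : ∀ {d} → Regular d G → parity d ≡ 0ℙ
  parity-d≡0ℙ {d} regular = constant-columnSum≡0ℙ (parity d) (regular-columnSum G regular) (indicator ⁅ x₀ ⁆)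
                              (trans (sym (parity-∣p∣ ⁅ x₀ ⁆)) (cong parity (∣⁅x⁆∣≡1 x₀)))

  d≤k : ∀ {d} → Regular d G → d ≤ k
  d≤k regular = n*d≡m*k⇒d≤k (s≤s z≤n)
    (rank-bound ones x₀ (λ i → trans (·-ones (incidence G) i) (trans (uniform-rowSum G uniform i) parity-k≡0ℙ)) refl)
    (regular-uniform⇒n*d≡m*k G regular uniform)
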